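{- For every $n\ge1$ there exists an NFA $M$ with $n+1$ states over a three-letter alphabet $\Sigma$, all of whose states are final, such that every NFA accepting $\overline{L(M)}=\Sigma^*\setminus L(M)$ has at least $2^n$ states.
   Context: An NFA is $(Q,\Sigma,\delta,q_0,F)$ with a single initial state $q_0$, transition function $\delta:Q\times\Sigma\to2^Q$ and final states $F$; it accepts $w$ iff $\delta(q_0,w)\cap F\ne\emptyset$. -}

module Defs where

open import Data.Nat using (ℕ)
open import Data.Fin using (Fin)
open import Data.Bool using (Bool; true)
open import Data.List using (List; []; _∷_)
open import Data.Product using (∃; _×_)
open import Relation.Binary.PropositionalEquality using (_≡_)

record NFA (s k : ℕ) : Set where
  field
    δ     : Fin k → Fin s → Fin k → Bool
    q₀    : Fin k
    final : Fin k → Bool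

open NFA public

data Reach {s k : ℕ} (M : NFA s k) : Fin k → List (Fin s) → Fin k → Set where
  ε-step : ∀ {q} → Reach M q [] q
  a-step : ∀ {q q' q'' a w} → δ M q a q' ≡ true → Reach M q' w q'' →
           Reach M q (a ∷ w) q''

Accepts : {s k : ℕ} → NFA s k → List (Fin s) → Set
Accepts M w = ∃ λ q → Reach M (q₀ M) w q × final M q ≡ true

-- Encode a subset v of {0, …, n-1} by the word bits v over {a, b} (a for members).
-- The (n+1)-state automaton guesses a position of the first block carrying a, counts n - 1
-- letters across the separator c, and survives only if the corresponding position of the second
-- block carries a as well; on words bits v ++ c ∷ bits w it thus accepts iff v and w intersect.
-- An automaton N for the complement therefore accepts bits v ++ c ∷ bits (∁ v) for every v,
-- while for v ≢ u one of the cross words bits v ++ c ∷ bits (∁ u), bits u ++ c ∷ bits (∁ v)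
-- is accepted by the first automaton and hence rejected by N.  So the states in the middle of
-- these 2ⁿ accepting runs of N are pairwise distinct.
module Submission where

open import Defs
open import Data.Nat using (ℕ; zero; suc; _≤_; _^_; _+_; z≤n; s≤s)
open import Data.Nat.Properties using (_≟_; +-suc; +-comm; +-identityʳ; ≤-refl; ≤-trans; n≤1+n)
open import Data.Fin using (Fin; zero; suc; toℕ; fromℕ<; finToFun; funToFin; combine)
open import Data.Fin.Properties
  using (toℕ≤pred[n]; toℕ-fromℕ<; funToFin-finToFin; injective⇒≤; 2↔Bool)
open import Data.Fin.Subset using (Subset; _∈_; _⊆_; ∁)
open import Data.Fin.Subset.Properties using (_∈?_; ⊆-antisym; x∉p⇒x∈∁p; x∈∁p⇒x∉p)
open import Data.Bool using (Bool; true; false)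
open import Data.Bool.Properties using (T-≡)
open import Data.List using (List; []; _∷_; _++_)
open import Data.Vec using (Vec; []; _∷_; here; there; toList; map; tabulate; lookup)
open import Data.Vec.Properties using (lookup∘tabulate)
open import Data.Sum using (_⊎_; inj₁; inj₂)
open import Data.Product using (Σ; ∃-syntax; _×_; _,_; proj₁; proj₂)
open import Function using (_∘_; Injective)
open import Function.Bundles using (Inverse; Injection; Equivalence)
open import Function.Properties.Inverse using (Inverse⇒Injection)
open import Relation.Nullary using (¬_; Dec; yes; no; contradiction)
open import Relation.Nullary.Decidable using (⌊_⌋; toWitness; fromWitness)
open import Relation.Binary.PropositionalEquality
  using (_≡_; _≗_; refl; sym; trans; cong; cong₂; subst; module ≡-Reasoning)

private
  variable
    s k : ℕ
    S A I : Set

data Path (R : S → A → S → Set) : S → List A → S → Set where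
  []  : ∀ {q} → Path R q [] q
  _∷_ : ∀ {q x q′ w q″} → R q x q′ → Path R q′ w q″ → Path R q (x ∷ w) q″

reach-++ : {N : NFA s k} {q q″ : Fin k} (u : List (Fin s)) {v : List (Fin s)} →
           Reach N q (u ++ v) q″ → ∃[ q′ ] Reach N q u q′ × Reach N q′ v q″
reach-++ [] r = _ , ε-step , r
reach-++ (x ∷ u) (a-step e r) with reach-++ u r
... | q′ , r₁ , r₂ = q′ , a-step e r₁ , r₂

++-reach : {N : NFA s k} {q q′ q″ : Fin k} {u v : List (Fin s)} →
           Reach N q u q′ → Reach N q′ v q″ → Reach N q (u ++ v) q″
++-reach ε-step r₂ = r₂
++-reach (a-step e r₁) r₂ = a-step e (++-reach r₁ r₂)

-- Extended fooling sets: the state in the middle of an accepting run on xᵢ yᵢ determines i.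
fooling-set-injection : (N : NFA s k) (x y : I → List (Fin s)) →
  (∀ i → Accepts N (x i ++ y i)) →
  (∀ i j → Accepts N (x i ++ y j) → Accepts N (x j ++ y i) → i ≡ j) →
  Σ (I → Fin k) (Injective _≡_ _≡_)
fooling-set-injection {I = I} N x y accepts-xᵢyᵢ separated = middle , middle-injective
  where
  split : ∀ i → ∃[ q ] Reach N (q₀ N) (x i) q × Reach N q (y i) (proj₁ (accepts-xᵢyᵢ i))
  split i = reach-++ (x i) (proj₁ (proj₂ (accepts-xᵢyᵢ i)))

  middle : I → Fin _
  middle i = proj₁ (split i)

  cross : ∀ i j → middle i ≡ middle j → Accepts N (x i ++ y j)
  cross i j eq = proj₁ (accepts-xᵢyᵢ j) , ++-reach xᵢ yⱼ , proj₂ (proj₂ (accepts-xᵢyᵢ j))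
    where
    xᵢ : Reach N (q₀ N) (x i) (middle j)
    xᵢ = subst (Reach N (q₀ N) (x i)) eq (proj₁ (proj₂ (split i)))
    yⱼ : Reach N (middle j) (y j) (proj₁ (accepts-xᵢyᵢ j))
    yⱼ = proj₂ (proj₂ (split j))

  middle-injective : Injective _≡_ _≡_ middle
  middle-injective {i} {j} eq = separated i j (cross i j eq) (cross j i (sym eq))

restriction : (R : ℕ → Fin s → ℕ → Set) → (∀ i x j → Dec (R i x j)) → (k : ℕ) → NFA s (suc k)
restriction R R? k = record
  { δ     = λ q x q′ → ⌊ R? (toℕ q) x (toℕ q′) ⌋
  ; q₀    = zero
  ; final = λ _ → true
  }

module _ {R : ℕ → Fin s → ℕ → Set} (R? : ∀ i x j → Dec (R i x j)) {k : ℕ} where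

  private
    M : NFA s (suc k)
    M = restriction R R? k

    in-range : ∀ {j} → j ≤ k → ∃[ q ] toℕ {suc k} q ≡ j
    in-range j≤k = fromℕ< (s≤s j≤k) , toℕ-fromℕ< (s≤s j≤k)

  reach⇒path : ∀ {q w q′} → Reach M q w q′ → Path R (toℕ q) w (toℕ q′)
  reach⇒path ε-step       = []
  reach⇒path (a-step e r) = toWitness (Equivalence.from T-≡ e) ∷ reach⇒path r

  path⇒reach : (∀ {i x j} → i ≤ k → R i x j → j ≤ k) →
               ∀ q {w j} → Path R (toℕ q) w j → ∃[ q′ ] Reach M q w q′
  path⇒reach closed q [] = q , ε-step
  path⇒reach closed q (r ∷ p) with in-range (closed (toℕ≤pred[n] q) r)
  ... | q′ , refl with path⇒reach closed q′ p
  ... | q″ , r′ = q″ , a-step (Equivalence.to T-≡ (fromWitness r)) r′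

  accepts⇒path : ∀ {w} → Accepts M w → ∃[ j ] Path R 0 w j
  accepts⇒path (q , r , _) = toℕ q , reach⇒path r

  path⇒accepts : (∀ {i x j} → i ≤ k → R i x j → j ≤ k) → ∀ {w j} → Path R 0 w j → Accepts M w
  path⇒accepts closed p with q , r ← path⇒reach closed zero p = q , r , refl

pattern a = zero
pattern b = suc zero
pattern c = suc (suc zero)

-- State 0 idles on the first block and may start the counter on an a; state 1 + j lets j more
-- letters of a, b pass (and ignores c), after which only an a is allowed, leading back to 0.
data Step (n : ℕ) : ℕ → Fin 3 → ℕ → Set where
  wait-a : Step n 0 a 0
  wait-b : Step n 0 b 0
  start  : Step n 0 a n
  tick-a : ∀ {j} → Step n (suc (suc j)) a (suc j)
  tick-b : ∀ {j} → Step n (suc (suc j)) b (suc j)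
  check  : Step n 1 a 0
  hold   : ∀ {j} → Step n (suc j) c (suc j)

step? : ∀ n i x j → Dec (Step n i x j)
step? n zero a j with j ≟ 0 | j ≟ n
... | yes refl | _        = yes wait-a
... | no _     | yes refl = yes start
... | no j≢0   | no j≢n   = no λ { wait-a → j≢0 refl ; start → j≢n refl }
step? n zero b j with j ≟ 0
... | yes refl = yes wait-b
... | no j≢0   = no λ { wait-b → j≢0 refl }
step? n zero c j = no λ ()
step? n (suc zero) a j with j ≟ 0
... | yes refl = yes check
... | no j≢0   = no λ { check → j≢0 refl }
step? n (suc zero) b j = no λ ()
step? n (suc (suc i)) a j with j ≟ suc i
... | yes refl = yes tick-a
... | no j≢1+i = no λ { tick-a → j≢1+i refl }
step? n (suc (suc i)) b j with j ≟ suc i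
... | yes refl = yes tick-b
... | no j≢1+i = no λ { tick-b → j≢1+i refl }
step? n (suc i) c j with j ≟ suc i
... | yes refl = yes hold
... | no j≢1+i = no λ { hold → j≢1+i refl }

step-closed : ∀ {n i x j} → i ≤ n → Step n i x j → j ≤ n
step-closed _   wait-a = z≤n
step-closed _   wait-b = z≤n
step-closed _   start  = ≤-refl
step-closed i≤n tick-a = ≤-trans (n≤1+n _) i≤n
step-closed i≤n tick-b = ≤-trans (n≤1+n _) i≤n
step-closed _   check  = z≤n
step-closed i≤n hold   = i≤n

bit : Bool → Fin 3
bit true  = a
bit false = b

bits : Vec Bool k → List (Fin 3)
bits v = toList (map bit v)

module _ {n : ℕ} where

  private
    Run : ℕ → List (Fin 3) → ℕ → Set
    Run = Path (Step n)

  wait : ∀ x → Step n 0 (bit x) 0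
  wait true  = wait-a
  wait false = wait-b

  tick : ∀ {j} x → Step n (suc (suc j)) (bit x) (suc j)
  tick true  = tick-a
  tick false = tick-b

  tick⁻¹ : ∀ {j j′} x → Step n (suc (suc j)) (bit x) j′ → j′ ≡ suc j
  tick⁻¹ true  tick-a = refl
  tick⁻¹ false tick-b = refl

  waiting : (w : Vec Bool k) → Run 0 (bits w) 0
  waiting []      = []
  waiting (x ∷ w) = wait x ∷ waiting w

  ticking : ∀ {j rest t} (w : Vec Bool k) →
            Run (suc j) rest t → Run (suc (k + j)) (bits w ++ rest) t
  ticking []      p = p
  ticking (x ∷ w) p = tick x ∷ ticking w p

  ticking⁻¹ : ∀ {j rest t} (w : Vec Bool k) →
              Run (suc (k + j)) (bits w ++ rest) t → Run (suc j) rest t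
  ticking⁻¹ []      p       = p
  ticking⁻¹ (x ∷ w) (r ∷ p) with refl ← tick⁻¹ x r = ticking⁻¹ w p

  checking : ∀ {w : Vec Bool k} {i} → i ∈ w → ∃[ t ] Run (suc (toℕ i)) (bits w) t
  checking {w = true ∷ w} here = 0 , check ∷ waiting w
  checking {w = x ∷ w} (there i∈w) with t , p ← checking i∈w = t , tick x ∷ p

  checking⁻¹ : ∀ {t} (w : Vec Bool k) i → Run (suc (toℕ i)) (bits w) t → i ∈ w
  checking⁻¹ (true ∷ w)  zero    _       = here
  checking⁻¹ (false ∷ w) zero    (() ∷ _)
  checking⁻¹ (x ∷ w)     (suc i) (r ∷ p) with refl ← tick⁻¹ x r = there (checking⁻¹ w i p)

  cast-run : ∀ {i j w t} → i ≡ j → Run i w t → Run j w t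
  cast-run refl p = p

  private
    start-target : ∀ {m k} → m + suc k ≡ n → n ≡ suc (k + m)
    start-target {m} {k} eq = trans (sym eq) (trans (+-suc m k) (cong suc (+-comm m k)))

    skip-one : ∀ {m k} → m + suc k ≡ n → suc m + k ≡ n
    skip-one {m} {k} eq = trans (sym (+-suc m k)) eq

    leave-0 : ∀ {j} x → Step n 0 (bit x) j → (x ≡ true × j ≡ n) ⊎ j ≡ 0
    leave-0 true  wait-a = inj₂ refl
    leave-0 true  start  = inj₁ (refl , refl)
    leave-0 false wait-b = inj₂ refl

  -- A run that starts the counter at position m + i of the first block ends that block in
  -- state 1 + m + i, so the counter then checks position m + i of the second block.
  selecting : ∀ {m rest t} (v : Vec Bool k) {i} → m + k ≡ n → i ∈ v →
              Run (suc (toℕ i + m)) rest t → Run 0 (bits v ++ c ∷ rest) t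
  selecting (true ∷ v) eq here p =
    start ∷ cast-run (sym (start-target eq)) (ticking v (hold ∷ p))
  selecting {m = m} (x ∷ v) {suc i} eq (there i∈v) p =
    wait x ∷ selecting v (skip-one eq) i∈v (cast-run (cong suc (sym (+-suc (toℕ i) m))) p)

  selecting⁻¹ : ∀ {m rest t} (v : Vec Bool k) → m + k ≡ n → Run 0 (bits v ++ c ∷ rest) t →
                ∃[ i ] i ∈ v × Run (suc (toℕ i + m)) rest t
  selecting⁻¹ [] _ (() ∷ _)
  selecting⁻¹ (x ∷ v) eq (r ∷ p) with leave-0 x r
  ... | inj₁ (refl , refl) with hold ∷ p′ ← ticking⁻¹ v (cast-run (start-target eq) p)
    = zero , here , p′
  selecting⁻¹ {m = m} (x ∷ v) eq (r ∷ p) | inj₂ refl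
    with i , i∈v , p′ ← selecting⁻¹ v (skip-one eq) p
    = suc i , there i∈v , cast-run (cong suc (+-suc (toℕ i) m)) p′

intersection-nfa : (n : ℕ) → NFA 3 (suc n)
intersection-nfa n = restriction (Step n) (step? n) n

module _ {n : ℕ} {v w : Subset n} where

  accepts-intersecting : ∀ {i} → i ∈ v → i ∈ w → Accepts (intersection-nfa n) (bits v ++ c ∷ bits w)
  accepts-intersecting {i} i∈v i∈w with t , p ← checking i∈w =
    path⇒accepts (step? n) step-closed
      (selecting v refl i∈v (cast-run (cong suc (sym (+-identityʳ (toℕ i)))) p))

  accepts⇒intersecting : Accepts (intersection-nfa n) (bits v ++ c ∷ bits w) → ∃[ i ] i ∈ v × i ∈ w
  accepts⇒intersecting acc
    with t , p ← accepts⇒path (step? n) acc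
    with i , i∈v , p′ ← selecting⁻¹ v refl p =
    i , i∈v , checking⁻¹ w i (cast-run (cong suc (+-identityʳ (toℕ i))) p′)

module _ {n : ℕ} where

  rejects-diagonal : (v : Subset n) → ¬ Accepts (intersection-nfa n) (bits v ++ c ∷ bits (∁ v))
  rejects-diagonal v accepted with i , i∈v , i∈∁v ← accepts⇒intersecting accepted =
    x∈∁p⇒x∉p i∈∁v i∈v

  rejects⇒⊆ : ∀ {v u : Subset n} → ¬ Accepts (intersection-nfa n) (bits v ++ c ∷ bits (∁ u)) → v ⊆ u
  rejects⇒⊆ {u = u} rejected {i} i∈v with i ∈? u
  ... | yes i∈u = i∈u
  ... | no  i∉u = contradiction (accepts-intersecting i∈v (x∉p⇒x∈∁p i∉u)) rejected

funToFin-cong : ∀ {m n} {f g : Fin m → Fin n} → f ≗ g → funToFin f ≡ funToFin g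
funToFin-cong {zero}  _   = refl
funToFin-cong {suc m} f≗g = cong₂ combine (f≗g zero) (funToFin-cong (f≗g ∘ suc))

subsetOf : ∀ {n} → Fin (2 ^ n) → Subset n
subsetOf i = tabulate (Inverse.to 2↔Bool ∘ finToFun i)

subsetOf-injective : ∀ {n} → Injective _≡_ _≡_ (subsetOf {n})
subsetOf-injective {n} {i} {j} eq = begin
  i                              ≡⟨ funToFin-finToFin {n} i ⟨
  funToFin (finToFun {2} {n} i)  ≡⟨ funToFin-cong (2↔Bool-injective ∘ same-bit) ⟩
  funToFin (finToFun {2} {n} j)  ≡⟨ funToFin-finToFin {n} j ⟩
  j                              ∎
  where
  open ≡-Reasoning
  2↔Bool-injective : Injective _≡_ _≡_ (Inverse.to 2↔Bool)
  2↔Bool-injective = Injection.injective (Inverse⇒Injection 2↔Bool)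

  same-bit : ∀ x → Inverse.to 2↔Bool (finToFun i x) ≡ Inverse.to 2↔Bool (finToFun j x)
  same-bit x = begin
    Inverse.to 2↔Bool (finToFun i x)  ≡⟨ lookup∘tabulate _ x ⟨
    lookup (subsetOf i) x             ≡⟨ cong (λ v → lookup v x) eq ⟩
    lookup (subsetOf j) x             ≡⟨ lookup∘tabulate _ x ⟩
    Inverse.to 2↔Bool (finToFun j x)  ∎

theorem11 : (n : ℕ) → 1 ≤ n →
    Σ (NFA 3 (suc n)) λ M →
      ((q : Fin (suc n)) → final M q ≡ true) ×
      ((m : ℕ) (N : NFA 3 m) →
        ((w : List (Fin 3)) → (Accepts N w → ¬ Accepts M w) × (¬ Accepts M w → Accepts N w)) →
        2 ^ n ≤ m)
theorem11 n _ = intersection-nfa n , (λ _ → refl) , lower-bound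
  where
  lower-bound : (m : ℕ) (N : NFA 3 m) →
    ((w : List (Fin 3)) → (Accepts N w → ¬ Accepts (intersection-nfa n) w) ×
                          (¬ Accepts (intersection-nfa n) w → Accepts N w)) →
    2 ^ n ≤ m
  lower-bound m N complement = injective⇒≤ (subsetOf-injective ∘ proj₂ fooling-set)
    where
    fooling-set : Σ (Subset n → Fin m) (Injective _≡_ _≡_)
    fooling-set = fooling-set-injection N bits (λ v → c ∷ bits (∁ v))
      (λ v → proj₂ (complement _) (rejects-diagonal v))
      (λ v u accepted₁ accepted₂ → ⊆-antisym (rejects⇒⊆ (proj₁ (complement _) accepted₁))
                                             (rejects⇒⊆ (proj₁ (complement _) accepted₂)))
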